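{- Let $n,k$ be integers with $2\leq k\leq n$, and let $G$ be a connected graph of order $n$. If $sdiam_k(G)=k-1$, then $0\leq \Delta(\overline{G})\leq k-2$, equivalently $n-k+1\leq \delta(G)\leq n-1$.
   Context: All graphs are finite, simple and undirected; $\overline{G}$ is the complement of $G$, and $\Delta,\delta$ denote maximum and minimum degree. For $S\subseteq V(G)$ with $|S|\geq 2$, the Steiner distance $d_G(S)$ is the minimum number of edges of a tree in $G$ whose vertex set contains $S$, and $sdiam_k(G)$ is the maximum of $d_G(S)$ over all $S\subseteq V(G)$ with $|S|=k$. -}

module Defs where

open import Data.Nat using (ℕ; zero; suc; _+_; _≤_; _⊔_; _⊓_; _<ᵇ_)
open import Data.Bool using (Bool; true; false; not; _∧_; if_then_else_)
open import Data.Fin using (Fin; zero; suc; toℕ; inject₁; fromℕ; _≟_)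
open import Data.Fin.Subset using (Subset; _∈_; _⊆_)
open import Data.List using (List; map; foldr)
open import Data.Nat.ListAction using (sum)
open import Data.List.Base using (allFin)
open import Data.Product using (Σ; _×_; ∃)
open import Function.Definitions using (Injective)
open import Relation.Nullary using (¬_)
open import Relation.Nullary.Decidable using (⌊_⌋)
open import Relation.Binary.PropositionalEquality using (_≡_)

Adj : ℕ → Set
Adj n = Fin n → Fin n → Bool

IsSimple : {n : ℕ} → Adj n → Set
IsSimple {n} G = (∀ (u v : Fin n) → G u v ≡ G v u) × (∀ (v : Fin n) → G v v ≡ false)

complement : {n : ℕ} → Adj n → Adj n
complement G u v = not (G u v) ∧ not ⌊ u ≟ v ⌋

deg : {n : ℕ} → Adj n → Fin n → ℕ
deg {n} G v = sum (map (λ u → if G v u then 1 else 0) (allFin n))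

maxDeg : {n : ℕ} → Adj n → ℕ
maxDeg {n} G = foldr _⊔_ 0 (map (deg G) (allFin n))

-- Minimum degree; the seed n exceeds every degree of a simple graph, so for
-- n ≥ 1 this is the minimum of the vertex degrees.
minDeg : {n : ℕ} → Adj n → ℕ
minDeg {n} G = foldr _⊓_ n (map (deg G) (allFin n))

data Walk {n : ℕ} (G : Adj n) : Fin n → Fin n → Set where
  here : ∀ {u} → Walk G u u
  step : ∀ {u v w} → G u v ≡ true → Walk G v w → Walk G u w

Connected : {n : ℕ} → Adj n → Set
Connected {n} G = ∀ (u v : Fin n) → Walk G u v

HasCycle : {n : ℕ} → Adj n → Set
HasCycle {n} H =
  Σ ℕ λ m → Σ (Fin (suc (suc (suc m))) → Fin n) λ f →
    Injective _≡_ _≡_ f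
    × (∀ (i : Fin (suc (suc m))) → H (f (inject₁ i)) (f (suc i)) ≡ true)
    × (H (f (fromℕ (suc (suc m)))) (f zero) ≡ true)

edgeCount : {n : ℕ} → Adj n → ℕ
edgeCount {n} H =
  sum (map (λ u → sum (map (λ v → if (toℕ u <ᵇ toℕ v) ∧ H u v then 1 else 0)
                           (allFin n)))
           (allFin n))

SteinerTree : {n : ℕ} → Adj n → Subset n → ℕ → Set
SteinerTree {n} G S m =
  Σ (Adj n) λ H → Σ (Subset n) λ Vs →
    IsSimple H
    × (∀ (u v : Fin n) → H u v ≡ true → G u v ≡ true)
    × (∀ (u v : Fin n) → H u v ≡ true → u ∈ Vs)
    × S ⊆ Vs
    × (∀ (u v : Fin n) → u ∈ Vs → v ∈ Vs → Walk H u v)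
    × ¬ HasCycle H
    × edgeCount H ≡ m

IsSteinerDist : {n : ℕ} → Adj n → Subset n → ℕ → Set
IsSteinerDist G S d = SteinerTree G S d × (∀ m → SteinerTree G S m → d ≤ m)

IsSdiam : {n : ℕ} → Adj n → ℕ → ℕ → Set
IsSdiam {n} G k D =
  (Σ (Subset n) λ S → (Data.Fin.Subset.∣ S ∣ ≡ k) × IsSteinerDist G S D)
  × (∀ (S : Subset n) → Data.Fin.Subset.∣ S ∣ ≡ k → ∀ d → IsSteinerDist G S d → d ≤ D)

module Submission where

-- Write k = k′ + 2.  The degree identity
-- deg_G(v) + deg_Ḡ(v) + 1 = n turns both conclusions into the single claim
-- that every vertex v has at most k′ = k − 2 non-neighbours.  Suppose v had
-- k′ + 1 of them and let S consist of v and k′ + 1 non-neighbours, so |S| = k.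
--   * Since G is connected, S has a Steiner tree: grow a tree from v one
--     pendant edge at a time until it covers S (the tree-growth module).
--   * Every Steiner tree of S has at least k edges: the first tree edge at v
--     leads to a vertex x ∉ S, so the tree connects the k + 1 vertices S ∪ {x},
--     and a graph connecting c vertices has at least c − 1 edges (again by
--     growing a spanning tree inside it).
-- Hence the Steiner distance of S, which exists as the least tree size,
-- exceeds sdiam_k(G) = k − 1, a contradiction.

open import Defs
open import Data.Nat using (ℕ; zero; suc; _+_; _∸_; _≤_; _<_; _<ᵇ_; z≤n; s≤s; s≤s⁻¹; _≤?_)
open import Data.Nat.Properties
  using ( +-identityʳ; +-comm; +-assoc; +-suc; +-mono-≤; +-monoʳ-≤; +-cancelʳ-≡; +-cancelʳ-≤
        ; m≤m+n; m+n∸n≡m; m∸n+n≡m; 0≢1+n; n<1+n; ≤-trans; ≤-reflexive; ≮⇒≥; ≰⇒>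
        ; <-irrefl; <-asym; <-cmp; <ᵇ⇒<; <⇒<ᵇ; ⊔-lub; ⊓-glb; m⊓n≤m; module ≤-Reasoning )
open import Data.Nat.Induction using (<-rec)
open import Data.Nat.Solver using (module +-*-Solver)
open import Data.Nat.ListAction using (sum)
open import Data.Bool using (Bool; true; false; not; _∧_; _∨_; if_then_else_)
open import Data.Bool.Properties using (∨-identityʳ; ∧-zeroʳ; ∧-comm; ∨-comm; ¬-not; not-injective; T-≡)
import Data.Bool.Properties as Bool
open import Data.Fin using (Fin; zero; suc; toℕ; inject₁; fromℕ; _≟_; lower₁)
import Data.Fin.Properties as Finₚ
open import Data.Fin.Subset using (Subset; _∈_; ∣_∣)
open import Data.List using (map)
open import Data.List.Base using (allFin)
open import Data.List.Properties using (map-tabulate; foldr-preservesᵇ)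
open import Data.List.Relation.Unary.All using (universal)
open import Data.List.Relation.Unary.All.Properties using (map⁺)
open import Data.Product using (Σ; _×_; _,_; proj₁; proj₂; uncurry)
open import Data.Sum using (_⊎_; inj₁; inj₂)
open import Data.Empty using (⊥; ⊥-elim)
import Data.Vec as Vec
open import Data.Vec.Properties using (lookup∘tabulate; lookup⇒[]=; []=⇒lookup)
open import Data.Vec.Functional using (_∷_)
open import Function using (_∘_)
open import Function.Bundles using (Equivalence)
open import Relation.Binary.Definitions using (tri<; tri≈; tri>)
open import Relation.Binary.PropositionalEquality
open import Relation.Nullary using (¬_; yes; no)
open import Relation.Nullary.Decidable using (⌊_⌋)

open +-*-Solver using (solve; _:+_; _:=_; con)

sumF : ∀ {n} → (Fin n → ℕ) → ℕ
sumF {n} f = sum (map f (allFin n))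

sumF-suc : ∀ {n} (f : Fin (suc n) → ℕ) → sumF f ≡ f zero + sumF (f ∘ suc)
sumF-suc f = cong (λ xs → f zero + sum xs)
  (trans (map-tabulate suc f) (sym (map-tabulate (λ i → i) (f ∘ suc))))

sumF-cong : ∀ {n} {f g : Fin n → ℕ} → (∀ u → f u ≡ g u) → sumF f ≡ sumF g
sumF-cong {zero}      e = refl
sumF-cong {suc n} {f} {g} e = begin
  sumF f                   ≡⟨ sumF-suc f ⟩
  f zero + sumF (f ∘ suc)  ≡⟨ cong₂ _+_ (e zero) (sumF-cong (e ∘ suc)) ⟩
  g zero + sumF (g ∘ suc)  ≡⟨ sumF-suc g ⟨
  sumF g                   ∎
  where open ≡-Reasoning

sumF-mono : ∀ {n} {f g : Fin n → ℕ} → (∀ u → f u ≤ g u) → sumF f ≤ sumF g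
sumF-mono {zero}          le = z≤n
sumF-mono {suc n} {f} {g} le rewrite sumF-suc f | sumF-suc g =
  +-mono-≤ (le zero) (sumF-mono (le ∘ suc))

sumF-+ : ∀ {n} (f g : Fin n → ℕ) → sumF (λ u → f u + g u) ≡ sumF f + sumF g
sumF-+ {zero}  f g = refl
sumF-+ {suc n} f g
  rewrite sumF-suc (λ u → f u + g u) | sumF-suc f | sumF-suc g | sumF-+ (f ∘ suc) (g ∘ suc) =
  solve 4 (λ a b c d → a :+ b :+ (c :+ d) := a :+ c :+ (b :+ d)) refl
    (f zero) (g zero) (sumF (f ∘ suc)) (sumF (g ∘ suc))

sumF-zero : ∀ {n} {f : Fin n → ℕ} → (∀ u → f u ≡ 0) → sumF f ≡ 0
sumF-zero {zero}      _    = refl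
sumF-zero {suc n} {f} all0 rewrite sumF-suc f | all0 zero = sumF-zero (all0 ∘ suc)

sumF-update : ∀ {n} (f g : Fin n → ℕ) (w : Fin n) → (∀ u → u ≢ w → g u ≡ f u)
            → sumF g + f w ≡ sumF f + g w
sumF-update {suc n} f g zero same
  rewrite sumF-suc f | sumF-suc g | sumF-cong {f = g ∘ suc} (λ u → same (suc u) (λ ())) =
  solve 3 (λ a x b → b :+ x :+ a := a :+ x :+ b) refl (f zero) (sumF (f ∘ suc)) (g zero)
sumF-update {suc n} f g (suc w) same rewrite sumF-suc f | sumF-suc g | same zero (λ ()) = begin
  f zero + sumF (g ∘ suc) + f (suc w)    ≡⟨ +-assoc (f zero) _ _ ⟩
  f zero + (sumF (g ∘ suc) + f (suc w))  ≡⟨ cong (f zero +_) rest ⟩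
  f zero + (sumF (f ∘ suc) + g (suc w))  ≡⟨ +-assoc (f zero) _ _ ⟨
  f zero + sumF (f ∘ suc) + g (suc w)    ∎
  where
  open ≡-Reasoning
  rest : sumF (g ∘ suc) + f (suc w) ≡ sumF (f ∘ suc) + g (suc w)
  rest = sumF-update (f ∘ suc) (g ∘ suc) w (λ u u≢w → same (suc u) (u≢w ∘ Finₚ.suc-injective))

sumF-bump : ∀ {n} (f g : Fin n → ℕ) (w : Fin n) → (∀ u → u ≢ w → g u ≡ f u)
          → f w ≡ 0 → g w ≡ 1 → sumF g ≡ suc (sumF f)
sumF-bump f g w same fw≡0 gw≡1 = begin
  sumF g           ≡⟨ +-identityʳ (sumF g) ⟨
  sumF g + 0       ≡⟨ cong (sumF g +_) fw≡0 ⟨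
  sumF g + f w     ≡⟨ sumF-update f g w same ⟩
  sumF f + g w     ≡⟨ cong (sumF f +_) gw≡1 ⟩
  sumF f + 1       ≡⟨ +-comm (sumF f) 1 ⟩
  suc (sumF f)     ∎
  where open ≡-Reasoning

sumF-one : ∀ {n} → sumF {n} (λ _ → 1) ≡ n
sumF-one {zero}  = refl
sumF-one {suc n} = trans (sumF-suc {n} (λ _ → 1)) (cong suc (sumF-one {n}))

-- The 0/1 indicator of a Boolean; `deg H v` is definitionally `count (H v)`.
ind : Bool → ℕ
ind b = if b then 1 else 0

count : ∀ {n} → (Fin n → Bool) → ℕ
count b = sumF (ind ∘ b)

count-empty : ∀ {n} (b : Fin n → Bool) → (∀ u → b u ≡ false) → count b ≡ 0
count-empty b none = sumF-zero (λ u → cong ind (none u))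

count-≤ : ∀ {n} (b : Fin n → Bool) → count b ≤ n
count-≤ {n} b = subst (count b ≤_) (sumF-one {n}) (sumF-mono ind≤1)
  where
  ind≤1 : ∀ u → ind (b u) ≤ 1
  ind≤1 u with b u
  ... | false = z≤n
  ... | true  = s≤s z≤n

count-mono : ∀ {n} {b c : Fin n → Bool} → (∀ u → b u ≡ true → c u ≡ true) → count b ≤ count c
count-mono {b = b} {c} b⊆c = sumF-mono ind-mono
  where
  ind-mono : ∀ u → ind (b u) ≤ ind (c u)
  ind-mono u with b u in bu
  ... | false = z≤n
  ... | true rewrite b⊆c u bu = s≤s z≤n

count-witness : ∀ {n} (b : Fin n → Bool) {j} → count b ≡ suc j → Σ (Fin n) λ u → b u ≡ true
count-witness b cb with Finₚ.any? (λ u → b u Bool.≟ true)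
... | yes found = found
... | no  none  = ⊥-elim (0≢1+n (trans (sym (count-empty b (λ u → ¬-not (λ bu → none (u , bu))))) cb))

_==_ : ∀ {n} → Fin n → Fin n → Bool
u == v = ⌊ u ≟ v ⌋

==-sound : ∀ {n} {u v : Fin n} → u == v ≡ true → u ≡ v
==-sound {u = u} {v} e with u ≟ v
... | yes u≡v = u≡v

==-refl : ∀ {n} (u : Fin n) → u == u ≡ true
==-refl u with u ≟ u
... | yes _   = refl
... | no  u≢u = ⊥-elim (u≢u refl)

==-≢ : ∀ {n} {u v : Fin n} → u ≢ v → u == v ≡ false
==-≢ {u = u} {v} u≢v with u ≟ v
... | yes u≡v = ⊥-elim (u≢v u≡v)
... | no  _   = refl

true≢false : ∀ {b} → b ≡ true → b ≡ false → ⊥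
true≢false refl ()

∨-cases : ∀ {b c} → b ∨ c ≡ true → (b ≡ true) ⊎ (c ≡ true)
∨-cases {true}  _ = inj₁ refl
∨-cases {false} e = inj₂ e

∧-parts : ∀ {b c} → b ∧ c ≡ true → (b ≡ true) × (c ≡ true)
∧-parts {true} {true} _ = refl , refl

∨-introˡ : ∀ {b} c → b ≡ true → b ∨ c ≡ true
∨-introˡ c refl = refl

∨-introʳ : ∀ b {c} → c ≡ true → b ∨ c ≡ true
∨-introʳ true  _ = refl
∨-introʳ false e = e

insert : ∀ {n} → (Fin n → Bool) → Fin n → Fin n → Bool
insert b w u = b u ∨ (u == w)

insert-old : ∀ {n} (b : Fin n → Bool) w {u} → b u ≡ true → insert b w u ≡ true
insert-old b w {u} = ∨-introˡ (u == w)

insert-new : ∀ {n} (b : Fin n → Bool) w → insert b w w ≡ true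
insert-new b w = ∨-introʳ (b w) (==-refl w)

insert-cases : ∀ {n} (b : Fin n → Bool) w {u} → insert b w u ≡ true → (b u ≡ true) ⊎ (u ≡ w)
insert-cases b w e with ∨-cases e
... | inj₁ bu   = inj₁ bu
... | inj₂ u==w = inj₂ (==-sound u==w)

count-insert : ∀ {n} (b : Fin n → Bool) {w} → b w ≡ false → count (insert b w) ≡ suc (count b)
count-insert b {w} bw = sumF-bump (ind ∘ b) (ind ∘ insert b w) w unchanged (cong ind bw) (cong ind (insert-new b w))
  where
  unchanged : ∀ u → u ≢ w → ind (insert b w u) ≡ ind (b u)
  unchanged u u≢w = cong ind (trans (cong (b u ∨_) (==-≢ u≢w)) (∨-identityʳ (b u)))

∷-⊆ : ∀ {n} {b : Fin (suc n) → Bool} {x} {c : Fin n → Bool}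
    → b zero ≡ x → (∀ u → c u ≡ true → b (suc u) ≡ true) → ∀ u → (x ∷ c) u ≡ true → b u ≡ true
∷-⊆ b0 c⊆b zero    e = trans b0 e
∷-⊆ b0 c⊆b (suc u) e = c⊆b u e

select : ∀ {n} (b : Fin n → Bool) j → j ≤ count b
       → Σ (Fin n → Bool) λ c → (∀ u → c u ≡ true → b u ≡ true) × count c ≡ j
select {zero}  b zero    _  = b , (λ _ bu → bu) , refl
select {suc n} b zero    _  = (λ _ → false) , (λ _ ()) , count-empty {suc n} (λ _ → false) (λ _ → refl)
select {suc n} b (suc j) le with b zero in b0 | subst (suc j ≤_) (sumF-suc (ind ∘ b)) le
... | true  | le′ with select (b ∘ suc) j (s≤s⁻¹ le′)
...   | c , c⊆b , cc = (true ∷ c) , ∷-⊆ b0 c⊆b , trans (sumF-suc (ind ∘ (true ∷ c))) (cong suc cc)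
select {suc n} b (suc j) le | false | le′ with select (b ∘ suc) (suc j) le′
...   | c , c⊆b , cc = (false ∷ c) , ∷-⊆ b0 c⊆b , trans (sumF-suc (ind ∘ (false ∷ c))) cc

toSubset : ∀ {n} → (Fin n → Bool) → Subset n
toSubset = Vec.tabulate

∈-toSubset : ∀ {n} (b : Fin n → Bool) {u} → b u ≡ true → u ∈ toSubset b
∈-toSubset b {u} bu = lookup⇒[]= u (toSubset b) (trans (lookup∘tabulate b u) bu)

toSubset-∈ : ∀ {n} (b : Fin n → Bool) {u} → u ∈ toSubset b → b u ≡ true
toSubset-∈ b {u} u∈ = trans (sym (lookup∘tabulate b u)) ([]=⇒lookup u∈)

∣toSubset∣ : ∀ {n} (b : Fin n → Bool) → ∣ toSubset b ∣ ≡ count b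
∣toSubset∣ {zero}  b = refl
∣toSubset∣ {suc n} b = begin
  ∣ toSubset b ∣                       ≡⟨ ∣∷∣ (b zero) ⟩
  ind (b zero) + ∣ toSubset (b ∘ suc) ∣ ≡⟨ cong (ind (b zero) +_) (∣toSubset∣ (b ∘ suc)) ⟩
  ind (b zero) + count (b ∘ suc)       ≡⟨ sumF-suc (ind ∘ b) ⟨
  count b                              ∎
  where
  open ≡-Reasoning
  ∣∷∣ : ∀ x → ∣ x Vec.∷ toSubset (b ∘ suc) ∣ ≡ ind x + ∣ toSubset (b ∘ suc) ∣
  ∣∷∣ true  = refl
  ∣∷∣ false = refl

-- Every other vertex is a neighbour of v in exactly one of G and its complement.
deg-complement : ∀ {n} (G : Adj n) → IsSimple G → ∀ v → deg G v + deg (complement G) v + 1 ≡ n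
deg-complement {n} G (_ , loopless) v = begin
  deg G v + deg (complement G) v + 1 ≡⟨ cong (_+ 1) (sumF-+ (ind ∘ G v) (ind ∘ complement G v)) ⟨
  sumF both + 1                      ≡⟨ sumF-update (λ _ → 1) both v both-off-v ⟩
  sumF {n} (λ _ → 1) + both v          ≡⟨ cong₂ _+_ (sumF-one {n}) both-at-v ⟩
  n + 0                              ≡⟨ +-identityʳ n ⟩
  n                                  ∎
  where
  open ≡-Reasoning
  both : Fin n → ℕ
  both u = ind (G v u) + ind (complement G v u)
  both-at-v : both v ≡ 0
  both-at-v rewrite loopless v | ==-refl v = refl
  both-off-v : ∀ u → u ≢ v → both u ≡ 1
  both-off-v u u≢v with G v u | v ≟ u
  ... | _     | yes v≡u = ⊥-elim (u≢v (sym v≡u))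
  ... | true  | no  _   = refl
  ... | false | no  _   = refl

deg-≤ : ∀ {n} (G : Adj n) → IsSimple G → ∀ v → deg G v ≤ n ∸ 1
deg-≤ {n} G simple v = begin
  deg G v                                ≤⟨ m≤m+n (deg G v) (deg (complement G) v) ⟩
  deg G v + deg (complement G) v         ≡⟨ m+n∸n≡m _ 1 ⟨
  deg G v + deg (complement G) v + 1 ∸ 1 ≡⟨ cong (_∸ 1) (deg-complement G simple v) ⟩
  n ∸ 1                                  ∎
  where open ≤-Reasoning

-- `maxDeg` and `minDeg` are folds of the degree list, so they inherit uniform degree bounds;
-- `minDeg` needs the bound to hold for its seed n as well.
maxDeg-≤ : ∀ {n} (H : Adj n) {b} → (∀ v → deg H v ≤ b) → maxDeg H ≤ b
maxDeg-≤ {n} H {b} all≤ = foldr-preservesᵇ {P = _≤ b} ⊔-lub z≤n (map⁺ (universal all≤ (allFin n)))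

minDeg-≥ : ∀ {n} (H : Adj n) {b} → b ≤ n → (∀ v → b ≤ deg H v) → b ≤ minDeg H
minDeg-≥ {n} H {b} b≤n all≥ = foldr-preservesᵇ {P = b ≤_} ⊓-glb b≤n (map⁺ (universal all≥ (allFin n)))

minDeg-≤ : ∀ {n} (H : Adj (suc n)) → minDeg H ≤ deg H zero
minDeg-≤ H = m⊓n≤m (deg H zero) _

-- The arithmetic turning "at most k − 2 non-neighbours" into "degree at least n − k + 1".
degree-from-antidegree : ∀ {n k d c} → k ≤ n → d + c + 1 ≡ n → 2 + c ≤ k → n ∸ k + 1 ≤ d
degree-from-antidegree {n} {k} {d} {c} k≤n sum≡n 2+c≤k = +-cancelʳ-≤ k (n ∸ k + 1) d (begin
  n ∸ k + 1 + k   ≡⟨ +-assoc (n ∸ k) 1 k ⟩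
  n ∸ k + suc k   ≡⟨ +-suc (n ∸ k) k ⟩
  suc (n ∸ k + k) ≡⟨ cong suc (m∸n+n≡m k≤n) ⟩
  suc n           ≡⟨ cong suc sum≡n ⟨
  suc (d + c + 1) ≡⟨ solve 2 (λ d c → con 1 :+ (d :+ c :+ con 1) := d :+ (con 2 :+ c)) refl d c ⟩
  d + (2 + c)     ≤⟨ +-monoʳ-≤ d 2+c≤k ⟩
  d + k           ∎)
  where open ≤-Reasoning

n∸k+1≤n : ∀ {n k} → k ≤ n → 1 ≤ k → n ∸ k + 1 ≤ n
n∸k+1≤n {n} {k} k≤n 1≤k = ≤-trans (+-monoʳ-≤ (n ∸ k) 1≤k) (≤-reflexive (m∸n+n≡m k≤n))

walk-mono : ∀ {n} {A B : Adj n} → (∀ u v → A u v ≡ true → B u v ≡ true) → ∀ {x y} → Walk A x y → Walk B x y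
walk-mono A⊆B here       = here
walk-mono A⊆B (step e p) = step (A⊆B _ _ e) (walk-mono A⊆B p)

walk-snoc : ∀ {n} {A : Adj n} {x y z} → Walk A x y → A y z ≡ true → Walk A x z
walk-snoc here        e = step e here
walk-snoc (step e′ p) e = step e′ (walk-snoc p e)

walk-++ : ∀ {n} {A : Adj n} {x y z} → Walk A x y → Walk A y z → Walk A x z
walk-++ here       q = q
walk-++ (step e p) q = step e (walk-++ p q)

walk-reverse : ∀ {n} {A : Adj n} → (∀ u v → A u v ≡ A v u) → ∀ {x y} → Walk A x y → Walk A y x
walk-reverse sym-A here                 = here
walk-reverse sym-A (step {u} {v} e p) = walk-snoc (walk-reverse sym-A p) (trans (sym-A v u) e)

first-step : ∀ {n} {A : Adj n} {x y} → Walk A x y → y ≢ x → Σ (Fin n) λ z → A x z ≡ true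
first-step here                 y≢x = ⊥-elim (y≢x refl)
first-step (step {v = z} e _) _   = z , e

leaving-edge : ∀ {n} {A : Adj n} (R : Fin n → Bool) {x y} → Walk A x y → R x ≡ true → R y ≡ false
             → Σ (Fin n) λ a → Σ (Fin n) λ w → R a ≡ true × R w ≡ false × A a w ≡ true
leaving-edge R here               Rx Ry = ⊥-elim (true≢false Rx Ry)
leaving-edge R (step {u} {z} e p) Rx Ry with R z in Rz
... | true  = leaving-edge R p Rz Ry
... | false = u , z , Rx , Rz , e

entry : ∀ {n} → Adj n → Fin n → Fin n → ℕ
entry A u v = ind ((toℕ u <ᵇ toℕ v) ∧ A u v)

edgeCount-mono : ∀ {n} (A B : Adj n) → (∀ u v → A u v ≡ true → B u v ≡ true) → edgeCount A ≤ edgeCount B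
edgeCount-mono A B A⊆B = sumF-mono (λ u → sumF-mono (λ v → entry-mono u v))
  where
  entry-mono : ∀ u v → entry A u v ≤ entry B u v
  entry-mono u v with toℕ u <ᵇ toℕ v
  ... | false = z≤n
  ... | true with A u v in Auv
  ...   | false = z≤n
  ...   | true rewrite A⊆B u v Auv = s≤s z≤n

edgeCount-add : ∀ {n} (A A′ : Adj n) (p q : Fin n) → toℕ p < toℕ q → A′ p q ≡ true → A p q ≡ false
              → (∀ u v → A u v ≡ true → A′ u v ≡ true)
              → (∀ u v → A′ u v ≡ true → A u v ≡ false → toℕ u < toℕ v → (u ≡ p) × (v ≡ q))
              → edgeCount A′ ≡ suc (edgeCount A)
edgeCount-add {n} A A′ p q p<q A′pq Apq A⊆A′ only-pq =
  +-cancelʳ-≡ (row A p) _ _ (begin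
    edgeCount A′ + row A p        ≡⟨ sumF-update (row A) (row A′) p other-rows ⟩
    edgeCount A + row A′ p        ≡⟨ cong (edgeCount A +_) row-p ⟩
    edgeCount A + suc (row A p)   ≡⟨ +-suc (edgeCount A) (row A p) ⟩
    suc (edgeCount A) + row A p   ∎)
  where
  open ≡-Reasoning
  row : Adj n → Fin n → ℕ
  row X u = sumF (entry X u)
  same-entry : ∀ u v → (u ≡ p → v ≡ q → ⊥) → entry A′ u v ≡ entry A u v
  same-entry u v not-pq with toℕ u <ᵇ toℕ v in u<v
  ... | false = refl
  ... | true with A u v in Auv
  ...   | true rewrite A⊆A′ u v Auv = refl
  ...   | false with A′ u v in A′uv
  ...     | false = refl
  ...     | true = ⊥-elim (uncurry not-pq (only-pq u v A′uv Auv (<ᵇ⇒< (toℕ u) (toℕ v) (Equivalence.from T-≡ u<v))))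
  p<ᵇq : (toℕ p <ᵇ toℕ q) ≡ true
  p<ᵇq = Equivalence.to T-≡ (<⇒<ᵇ p<q)
  entry-A : entry A p q ≡ 0
  entry-A rewrite p<ᵇq | Apq = refl
  entry-A′ : entry A′ p q ≡ 1
  entry-A′ rewrite p<ᵇq | A′pq = refl
  other-rows : ∀ u → u ≢ p → row A′ u ≡ row A u
  other-rows u u≢p = sumF-cong (λ v → same-entry u v (λ u≡p _ → u≢p u≡p))
  row-p : row A′ p ≡ suc (row A p)
  row-p = sumF-bump (entry A p) (entry A′ p) q (λ v v≢q → same-entry p v (λ _ → v≢q)) entry-A entry-A′

addEdge : ∀ {n} → Adj n → Fin n → Fin n → Adj n
addEdge T a w u v = T u v ∨ ((u == a ∧ v == w) ∨ (u == w ∧ v == a))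

module _ {n} (T : Adj n) (a w : Fin n) where

  addEdge-cases : ∀ {u v} → addEdge T a w u v ≡ true
                → (T u v ≡ true) ⊎ ((u ≡ a × v ≡ w) ⊎ (u ≡ w × v ≡ a))
  addEdge-cases {u} {v} e with ∨-cases {T u v} e
  ... | inj₁ old = inj₁ old
  ... | inj₂ new with ∨-cases {u == a ∧ v == w} new
  ...   | inj₁ aw = let u==a , v==w = ∧-parts aw in inj₂ (inj₁ (==-sound u==a , ==-sound v==w))
  ...   | inj₂ wa = let u==w , v==a = ∧-parts wa in inj₂ (inj₂ (==-sound u==w , ==-sound v==a))

  addEdge-old : ∀ u v → T u v ≡ true → addEdge T a w u v ≡ true
  addEdge-old u v = ∨-introˡ _

  addEdge-aw : addEdge T a w a w ≡ true
  addEdge-aw rewrite ==-refl a | ==-refl w = ∨-introʳ (T a w) refl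

  addEdge-wa : addEdge T a w w a ≡ true
  addEdge-wa rewrite ==-refl a | ==-refl w = ∨-introʳ (T w a) (∨-introʳ (w == a ∧ a == w) refl)

  addEdge-sym : (∀ u v → T u v ≡ T v u) → ∀ u v → addEdge T a w u v ≡ addEdge T a w v u
  addEdge-sym sym-T u v rewrite sym-T u v | ∧-comm (u == a) (v == w) | ∧-comm (u == w) (v == a) =
    cong (T v u ∨_) (∨-comm (v == w ∧ u == a) (v == a ∧ u == w))

  addEdge-loopless : a ≢ w → (∀ u → T u u ≡ false) → ∀ u → addEdge T a w u u ≡ false
  addEdge-loopless a≢w loopless u = ¬-not loop
    where
    loop : addEdge T a w u u ≢ true
    loop e with addEdge-cases e
    ... | inj₁ Tuu                 = true≢false Tuu (loopless u)
    ... | inj₂ (inj₁ (u≡a , u≡w)) = a≢w (trans (sym u≡a) u≡w)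
    ... | inj₂ (inj₂ (u≡w , u≡a)) = a≢w (trans (sym u≡a) u≡w)

  addEdge-⊆ : {K : Adj n} → (∀ u v → K u v ≡ K v u) → K a w ≡ true
            → (∀ u v → T u v ≡ true → K u v ≡ true) → ∀ u v → addEdge T a w u v ≡ true → K u v ≡ true
  addEdge-⊆ {K} sym-K Kaw T⊆K u v e with addEdge-cases e
  ... | inj₁ Tuv                 = T⊆K u v Tuv
  ... | inj₂ (inj₁ (refl , refl)) = Kaw
  ... | inj₂ (inj₂ (refl , refl)) = trans (sym-K w a) Kaw

  edgeCount-addEdge : a ≢ w → T a w ≡ false → T w a ≡ false
                    → edgeCount (addEdge T a w) ≡ suc (edgeCount T)
  edgeCount-addEdge a≢w Taw Twa with <-cmp (toℕ a) (toℕ w)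
  ... | tri≈ _ a≡w _ = ⊥-elim (a≢w (Finₚ.toℕ-injective a≡w))
  ... | tri< a<w _ _ = edgeCount-add T (addEdge T a w) a w a<w addEdge-aw Taw addEdge-old only
    where
    only : ∀ u v → addEdge T a w u v ≡ true → T u v ≡ false → toℕ u < toℕ v → (u ≡ a) × (v ≡ w)
    only u v e Tuv u<v with addEdge-cases e
    ... | inj₁ Tuv′                  = ⊥-elim (true≢false Tuv′ Tuv)
    ... | inj₂ (inj₁ aw)             = aw
    ... | inj₂ (inj₂ (refl , refl)) = ⊥-elim (<-asym u<v a<w)
  ... | tri> _ _ w<a = edgeCount-add T (addEdge T a w) w a w<a addEdge-wa Twa addEdge-old only
    where
    only : ∀ u v → addEdge T a w u v ≡ true → T u v ≡ false → toℕ u < toℕ v → (u ≡ w) × (v ≡ a)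
    only u v e Tuv u<v with addEdge-cases e
    ... | inj₁ Tuv′                  = ⊥-elim (true≢false Tuv′ Tuv)
    ... | inj₂ (inj₂ wa)             = wa
    ... | inj₂ (inj₁ (refl , refl)) = ⊥-elim (<-asym u<v w<a)

-- On a cycle f of length m + 3, each position j has a predecessor position p and a
-- successor position s, and p ≠ s because the cycle has at least three vertices.
cycle-neighbours : ∀ {n} {H : Adj n} m (f : Fin (suc (suc (suc m))) → Fin n)
  → (∀ i → H (f (inject₁ i)) (f (suc i)) ≡ true) → H (f (fromℕ (suc (suc m)))) (f zero) ≡ true
  → ∀ j → Σ _ λ p → Σ _ λ s → p ≢ s × H (f p) (f j) ≡ true × H (f j) (f s) ≡ true
cycle-neighbours m f edge close zero = fromℕ (suc (suc m)) , suc zero , (λ ()) , close , edge zero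
cycle-neighbours {H = H} m f edge close (suc j) with suc j ≟ fromℕ (suc (suc m))
... | yes j+1≡last =
  inject₁ j , zero , not-first j j+1≡last , edge j , subst (λ x → H (f x) (f zero) ≡ true) (sym j+1≡last) close
  where
  not-first : ∀ i → suc i ≡ fromℕ (suc (suc m)) → inject₁ i ≢ zero
  not-first zero    ()
  not-first (suc _) _ ()
... | no j+1≢last =
  inject₁ j , suc i , apart , edge j , subst (λ x → H (f x) (f (suc i)) ≡ true) (Finₚ.inject₁-lower₁ (suc j) not-last) (edge i)
  where
  not-last : suc (suc m) ≢ toℕ (suc j)
  not-last e = j+1≢last (Finₚ.toℕ-injective (trans (sym e) (sym (Finₚ.toℕ-fromℕ (suc (suc m))))))
  i = lower₁ (suc j) not-last
  -- Position i + 1 is two steps after position j.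
  apart : inject₁ j ≢ suc i
  apart e = x≢x+2 (begin
    toℕ j                 ≡⟨ Finₚ.toℕ-inject₁ j ⟨
    toℕ (inject₁ j)       ≡⟨ cong toℕ e ⟩
    suc (toℕ i)           ≡⟨ cong suc (Finₚ.toℕ-inject₁ i) ⟨
    suc (toℕ (inject₁ i)) ≡⟨ cong (suc ∘ toℕ) (Finₚ.inject₁-lower₁ (suc j) not-last) ⟩
    suc (suc (toℕ j))     ∎)
    where
    open ≡-Reasoning
    x≢x+2 : ∀ {x} → x ≢ suc (suc x)
    x≢x+2 ()

-- Attaching a pendant vertex w to an acyclic graph keeps it acyclic: on a cycle, w would
-- need two neighbours at different positions, but its only neighbour is a.
pendant-acyclic : ∀ {n} (T : Adj n) (a w : Fin n) → (∀ z → T w z ≡ false) → (∀ z → T z w ≡ false)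
                → ¬ HasCycle T → ¬ HasCycle (addEdge T a w)
pendant-acyclic {n} T a w w-isolated w-isolated′ acyclic (m , f , injective , edge , close) =
  acyclic (m , f , injective , (λ i → old-edge _ _ (edge i)) , old-edge _ _ close)
  where
  into-w : ∀ {z} → addEdge T a w z w ≡ true → z ≡ a
  into-w e with addEdge-cases T a w e
  ... | inj₁ Tzw                 = ⊥-elim (true≢false Tzw (w-isolated′ _))
  ... | inj₂ (inj₁ (z≡a , _))   = z≡a
  ... | inj₂ (inj₂ (z≡w , w≡a)) = trans z≡w w≡a
  out-of-w : ∀ {z} → addEdge T a w w z ≡ true → z ≡ a
  out-of-w e with addEdge-cases T a w e
  ... | inj₁ Twz                 = ⊥-elim (true≢false Twz (w-isolated _))
  ... | inj₂ (inj₁ (w≡a , z≡w)) = trans z≡w w≡a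
  ... | inj₂ (inj₂ (_ , z≡a))   = z≡a
  off-cycle : ∀ j → f j ≢ w
  off-cycle j fj≡w with cycle-neighbours {H = addEdge T a w} m f edge close j
  ... | p , s , p≢s , pj , js = p≢s (injective (trans (into-w (subst (λ x → addEdge T a w (f p) x ≡ true) fj≡w pj))
                                                   (sym (out-of-w (subst (λ x → addEdge T a w x (f s) ≡ true) fj≡w js)))))
  old-edge : ∀ i j → addEdge T a w (f i) (f j) ≡ true → T (f i) (f j) ≡ true
  old-edge i j e with addEdge-cases T a w e
  ... | inj₁ Tij              = Tij
  ... | inj₂ (inj₁ (_ , fj≡w)) = ⊥-elim (off-cycle j fj≡w)
  ... | inj₂ (inj₂ (fi≡w , _)) = ⊥-elim (off-cycle i fi≡w)

record RootedTree {n} (K : Adj n) (r : Fin n) : Set where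
  field
    edges      : Adj n
    span       : Fin n → Bool
    edges-sym  : ∀ u v → edges u v ≡ edges v u
    loopless   : ∀ u → edges u u ≡ false
    edges⊆K    : ∀ u v → edges u v ≡ true → K u v ≡ true
    edges⊆span : ∀ u v → edges u v ≡ true → span u ≡ true
    root∈span  : span r ≡ true
    reach      : ∀ u → span u ≡ true → Walk edges r u
    acyclic    : ¬ HasCycle edges
    size       : suc (edgeCount edges) ≡ count span

module TreeGrowth {n} (K : Adj n) (sym-K : ∀ u v → K u v ≡ K v u) (r : Fin n) where

  open RootedTree

  root-tree : RootedTree K r
  root-tree = record
    { edges      = λ _ _ → false
    ; span       = insert (λ _ → false) r
    ; edges-sym  = λ _ _ → refl
    ; loopless   = λ _ → refl
    ; edges⊆K    = λ _ _ ()
    ; edges⊆span = λ _ _ ()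
    ; root∈span  = insert-new (λ _ → false) r
    ; reach      = λ u u==r → subst (Walk _ r) (sym (==-sound u==r)) here
    ; acyclic    = λ { (_ , _ , _ , _ , ()) }
    ; size       = begin
        suc (edgeCount {n} (λ _ _ → false))  ≡⟨ cong suc no-edges ⟩
        1                                    ≡⟨ cong suc (count-empty {n} (λ _ → false) (λ _ → refl)) ⟨
        suc (count {n} (λ _ → false))        ≡⟨ count-insert {n} (λ _ → false) {r} refl ⟨
        count (insert (λ _ → false) r)       ∎
    }
    where
    open ≡-Reasoning
    no-edges : edgeCount {n} (λ _ _ → false) ≡ 0
    no-edges = sumF-zero {n} (λ u → sumF-zero {n} (λ v → cong ind (∧-zeroʳ (toℕ u <ᵇ toℕ v))))

  extend : (T : RootedTree K r) {a w : Fin n} → span T a ≡ true → span T w ≡ false → K a w ≡ true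
         → RootedTree K r
  extend T {a} {w} a∈T w∉T Kaw = record
    { edges      = addEdge (edges T) a w
    ; span       = insert (span T) w
    ; edges-sym  = addEdge-sym (edges T) a w (edges-sym T)
    ; loopless   = addEdge-loopless (edges T) a w a≢w (loopless T)
    ; edges⊆K    = addEdge-⊆ (edges T) a w sym-K Kaw (edges⊆K T)
    ; edges⊆span = edges⊆span′
    ; root∈span  = insert-old (span T) w (root∈span T)
    ; reach      = reach′
    ; acyclic    = pendant-acyclic (edges T) a w w-isolated w-isolated′ (acyclic T)
    ; size       = begin
        suc (edgeCount (addEdge (edges T) a w)) ≡⟨ cong suc (edgeCount-addEdge (edges T) a w a≢w (w-isolated′ a) (w-isolated a)) ⟩
        suc (suc (edgeCount (edges T)))         ≡⟨ cong suc (size T) ⟩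
        suc (count (span T))                    ≡⟨ count-insert (span T) w∉T ⟨
        count (insert (span T) w)               ∎
    }
    where
    open ≡-Reasoning
    a≢w : a ≢ w
    a≢w a≡w = true≢false (subst (λ x → span T x ≡ true) a≡w a∈T) w∉T
    w-isolated : ∀ z → edges T w z ≡ false
    w-isolated z = ¬-not (λ e → true≢false (edges⊆span T w z e) w∉T)
    w-isolated′ : ∀ z → edges T z w ≡ false
    w-isolated′ z = trans (edges-sym T z w) (w-isolated z)
    edges⊆span′ : ∀ u v → addEdge (edges T) a w u v ≡ true → insert (span T) w u ≡ true
    edges⊆span′ u v e with addEdge-cases (edges T) a w e
    ... | inj₁ Tuv                 = insert-old (span T) w (edges⊆span T u v Tuv)
    ... | inj₂ (inj₁ (refl , _))   = insert-old (span T) w a∈T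
    ... | inj₂ (inj₂ (refl , _))   = insert-new (span T) w
    reach′ : ∀ u → insert (span T) w u ≡ true → Walk (addEdge (edges T) a w) r u
    reach′ u u∈ with insert-cases (span T) w u∈
    ... | inj₁ u∈T = walk-mono (addEdge-old (edges T) a w) (reach T u u∈T)
    ... | inj₂ refl = walk-snoc (walk-mono (addEdge-old (edges T) a w) (reach T a a∈T)) (addEdge-aw (edges T) a w)

  module _ (targets : Fin n → Bool) (reachable : ∀ u → targets u ≡ true → Walk K r u) where

    grow : ∀ f → Σ (RootedTree K r) λ T → (∀ u → targets u ≡ true → span T u ≡ true) ⊎ (f ≤ count (span T))
    grow zero = root-tree , inj₂ z≤n
    grow (suc f) with grow f
    ... | T , inj₁ covered = T , inj₁ covered
    ... | T , inj₂ f≤size with Finₚ.any? (λ u → targets u ∧ not (span T u) Bool.≟ true)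
    ...   | no none = T , inj₁ covered
      where
      covered : ∀ u → targets u ≡ true → span T u ≡ true
      covered u tu = ¬-not (λ u∉T → none (u , trans (cong (λ x → targets u ∧ not x) u∉T) (cong (_∧ true) tu)))
    ...   | yes (u , missing) with ∧-parts missing
    ...     | tu , u∉T with leaving-edge (span T) (reachable u tu) (root∈span T) (not-injective u∉T)
    ...       | a , w , a∈T , w∉T , Kaw =
      extend T a∈T w∉T Kaw , inj₂ (subst (suc f ≤_) (sym (count-insert (span T) w∉T)) (s≤s f≤size))

    -- A tree in K covering all targets; n + 1 rounds suffice since no tree has n + 1 vertices.
    spanning-tree : Σ (RootedTree K r) λ T → ∀ u → targets u ≡ true → span T u ≡ true
    spanning-tree with grow (suc n)
    ... | T , inj₁ covered = T , covered
    ... | T , inj₂ too-big = ⊥-elim (<-irrefl refl (≤-trans too-big (count-≤ (span T))))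

steinerTree-exists : ∀ {n} (G : Adj n) → (∀ u v → G u v ≡ G v u) → (r : Fin n) (S : Fin n → Bool)
                   → (∀ u → S u ≡ true → Walk G r u) → Σ ℕ (SteinerTree G (toSubset S))
steinerTree-exists G sym-G r S reachable with TreeGrowth.spanning-tree G sym-G r S reachable
... | T , S⊆T = edgeCount edges , edges , toSubset span , (edges-sym , loopless) , edges⊆K
              , (λ u v e → ∈-toSubset span (edges⊆span u v e))
              , (λ u∈S → ∈-toSubset span (S⊆T _ (toSubset-∈ S u∈S)))
              , connects , acyclic , refl
  where
  open RootedTree T
  connects : ∀ u v → u ∈ toSubset span → v ∈ toSubset span → Walk edges u v
  connects u v u∈ v∈ = walk-++ (walk-reverse edges-sym (reach u (toSubset-∈ span u∈))) (reach v (toSubset-∈ span v∈))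

edgeCount-≥ : ∀ {n} (H : Adj n) → (∀ u v → H u v ≡ H v u) → (r : Fin n) (C : Fin n → Bool)
            → (∀ u → C u ≡ true → Walk H r u) → count C ≤ suc (edgeCount H)
edgeCount-≥ H sym-H r C reachable with TreeGrowth.spanning-tree H sym-H r C reachable
... | T , C⊆T = begin
  count C                ≤⟨ count-mono C⊆T ⟩
  count span             ≡⟨ size ⟨
  suc (edgeCount edges)  ≤⟨ s≤s (edgeCount-mono edges H edges⊆K) ⟩
  suc (edgeCount H)      ∎
  where
  open RootedTree T
  open ≤-Reasoning

record NonAdjacentSet {n} (G : Adj n) (v : Fin n) : Set where
  field
    members      : Fin n → Bool
    v∈           : members v ≡ true
    other        : Fin n
    other∈       : members other ≡ true
    other≢v      : other ≢ v
    no-neighbour : ∀ u → members u ≡ true → G v u ≡ false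

-- Every Steiner tree of such a set S has at least |S| edges: its first edge at v leads to
-- a vertex x ∉ S, so the tree connects the |S| + 1 vertices of S ∪ {x}.
steinerTree-≥ : ∀ {n} {G : Adj n} {v} (A : NonAdjacentSet G v) → let S = NonAdjacentSet.members A in
                ∀ m → SteinerTree G (toSubset S) m → count S ≤ m
steinerTree-≥ {G = G} {v} A m (H , Vs , (sym-H , _) , H⊆G , _ , S⊆Vs , connects , _ , size) =
  s≤s⁻¹ (begin
    suc (count S)            ≡⟨ count-insert S x∉S ⟨
    count (insert S x)       ≤⟨ edgeCount-≥ H sym-H v (insert S x) reachable ⟩
    suc (edgeCount H)        ≡⟨ cong suc size ⟩
    suc m                    ∎)
  where
  open NonAdjacentSet A renaming (members to S)
  open ≤-Reasoning
  in-tree : ∀ {u} → S u ≡ true → u ∈ Vs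
  in-tree u∈S = S⊆Vs (∈-toSubset S u∈S)
  first : Σ (Fin _) λ x → H v x ≡ true
  first = first-step (connects v other (in-tree v∈) (in-tree other∈)) other≢v
  x : Fin _
  x = proj₁ first
  x∉S : S x ≡ false
  x∉S = ¬-not (λ x∈S → true≢false (H⊆G v x (proj₂ first)) (no-neighbour x x∈S))
  reachable : ∀ u → insert S x u ≡ true → Walk H v u
  reachable u u∈ with insert-cases S x u∈
  ... | inj₁ u∈S = connects v u (in-tree v∈) (in-tree u∈S)
  ... | inj₂ refl = step (proj₂ first) here

-- A predicate on ℕ with a witness cannot lack a least element.  (The least element need
-- not be computable, but this negative form is all the contradiction below needs.)
minimum-not-absent : (P : ℕ → Set) → (∀ d → P d → (∀ m → P m → d ≤ m) → ⊥) → ∀ m → P m → ⊥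
minimum-not-absent P no-least = <-rec (λ m → P m → ⊥) not-least
  where
  not-least : ∀ m → (∀ {m′} → m′ < m → P m′ → ⊥) → P m → ⊥
  not-least m below Pm = no-least m Pm (λ m′ Pm′ → ≮⇒≥ (λ m′<m → below m′<m Pm′))

nonAdjacentSet : ∀ {n} (G : Adj n) → IsSimple G → ∀ {v} j → suc j ≤ deg (complement G) v
               → Σ (NonAdjacentSet G v) λ A → count (NonAdjacentSet.members A) ≡ suc (suc j)
nonAdjacentSet G (_ , loopless) {v} j many with select (complement G v) (suc j) many
... | N , N⊆Ḡ , |N| = record
  { members      = insert N v
  ; v∈           = insert-new N v
  ; other        = proj₁ (count-witness N |N|)
  ; other∈       = insert-old N v (proj₂ (count-witness N |N|))
  ; other≢v      = λ { refl → true≢false (proj₂ (count-witness N |N|)) v∉N }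
  ; no-neighbour = no-neighbour
  } , trans (count-insert N v∉N) (cong suc |N|)
  where
  v∉N : N v ≡ false
  v∉N = ¬-not (λ v∈N → true≢false (N⊆Ḡ v v∈N) (trans (cong (not (G v v) ∧_) (cong not (==-refl v))) (∧-zeroʳ _)))
  no-neighbour : ∀ u → insert N v u ≡ true → G v u ≡ false
  no-neighbour u u∈S with insert-cases N v u∈S
  ... | inj₁ u∈N = not-injective (proj₁ (∧-parts (N⊆Ḡ u u∈N)))
  ... | inj₂ refl = loopless u

-- If every k-subset (k = k′ + 2) has Steiner distance at most k − 1, no vertex has k − 1
-- non-neighbours: v with k − 1 non-neighbours forms a k-set whose Steiner trees all have
-- at least k edges, yet by connectivity it has a Steiner tree and hence a least one.
antidegree-bound : ∀ {n} k′ (G : Adj n) → IsSimple G → Connected G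
  → (∀ S → ∣ S ∣ ≡ suc (suc k′) → ∀ d → IsSteinerDist G S d → d ≤ suc k′)
  → ∀ v → deg (complement G) v ≤ k′
antidegree-bound k′ G simple@(sym-G , _) connected sdiam≤ v with deg (complement G) v ≤? k′
... | yes bounded = bounded
... | no  many    with nonAdjacentSet G simple k′ (≰⇒> many)
...   | A , |S| with steinerTree-exists G sym-G v (NonAdjacentSet.members A) (λ u _ → connected v u)
...     | m , tree = ⊥-elim (minimum-not-absent (SteinerTree G (toSubset S)) too-short m tree)
  where
  S : Fin _ → Bool
  S = NonAdjacentSet.members A
  too-short : ∀ d → SteinerTree G (toSubset S) d → (∀ m → SteinerTree G (toSubset S) m → d ≤ m) → ⊥
  too-short d tree least = <-irrefl refl (begin-strict
    d             ≤⟨ sdiam≤ (toSubset S) (trans (∣toSubset∣ S) |S|) d (tree , least) ⟩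
    suc k′        <⟨ n<1+n (suc k′) ⟩
    suc (suc k′)  ≡⟨ |S| ⟨
    count S       ≤⟨ steinerTree-≥ A d tree ⟩
    d             ∎)
    where open ≤-Reasoning

lemma2 : (n k : ℕ) → 2 ≤ k → k ≤ n → (G : Adj n) → IsSimple G → Connected G
    → IsSdiam G k (k ∸ 1)
    → (0 ≤ maxDeg (complement G) × maxDeg (complement G) ≤ k ∸ 2)
    × (n ∸ k + 1 ≤ minDeg G × minDeg G ≤ n ∸ 1)
lemma2 (suc n′) (suc (suc k′)) (s≤s (s≤s z≤n)) k≤n G simple connected (_ , sdiam≤) =
  (z≤n , maxDeg-≤ (complement G) antidegree≤) ,
  (minDeg-≥ G (n∸k+1≤n k≤n (s≤s z≤n)) degree≥ , ≤-trans (minDeg-≤ G) (deg-≤ G simple zero))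
  where
  antidegree≤ : ∀ v → deg (complement G) v ≤ k′
  antidegree≤ = antidegree-bound k′ G simple connected sdiam≤
  degree≥ : ∀ v → suc n′ ∸ suc (suc k′) + 1 ≤ deg G v
  degree≥ v = degree-from-antidegree k≤n (deg-complement G simple v) (s≤s (s≤s (antidegree≤ v)))
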